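{- Let $G_1$ and $G_2$ be finite simple graphs, where $G_i$ has $n_i$ vertices, $m_i$ edges, minimum degree $\delta_{G_i}$ and maximum degree $\Delta_{G_i}$ ($i=1,2$). Then $\alpha_1 \leq ESO(G_1+G_2)\leq \alpha_2$, where $$\alpha_1=2\sqrt{2}\,m_1(\delta_{G_1}+n_2)^2+2\sqrt{2}\,m_2(\delta_{G_2}+n_1)^2+n_1n_2(\delta_{G_1}+n_2+\delta_{G_2}+n_1)\{(\delta_{G_1}+n_2)^2+(\delta_{G_2}+n_1)^2\}^{\frac{1}{2}},$$ $$\alpha_2=2\sqrt{2}\,m_1(\Delta_{G_1}+n_2)^2+2\sqrt{2}\,m_2(\Delta_{G_2}+n_1)^2+n_1n_2(\Delta_{G_1}+n_2+\Delta_{G_2}+n_1)\{(\Delta_{G_1}+n_2)^2+(\Delta_{G_2}+n_1)^2\}^{\frac{1}{2}}.$$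
   Context: For a graph $G$ and vertex $u$, $d(u)$ denotes the degree of $u$ in $G$. The elliptic Sombor index of a graph $G$ is $ESO(G)=\sum_{uv\in E(G)}(d(u)+d(v))\sqrt{d(u)^2+d(v)^2}$. The join $G_1+G_2$ of graphs $G_1=(V_1,E_1)$ and $G_2=(V_2,E_2)$ (with disjoint vertex sets) is the graph with vertex set $V_1\cup V_2$ and edge set $E_1\cup E_2\cup\{v_1v_2: v_1\in V_1, v_2\in V_2\}$. -}

module Defs where

open import Level using (0ℓ)
open import Data.Nat as ℕ using (ℕ; zero; suc; _⊓_; _⊔_)
open import Data.Fin using (Fin; zero; suc; toℕ; splitAt)
open import Data.Bool using (Bool; true; false; if_then_else_; _∧_)
open import Data.Sum using (_⊎_; inj₁; inj₂)
open import Data.Product using (Σ; ∃; _×_; _,_)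
open import Relation.Binary.PropositionalEquality using (_≡_; _≢_)
open import Relation.Nullary using (¬_)
open import Relation.Nullary.Decidable using (⌊_⌋)
open import Algebra.Structures using (IsCommutativeRing)
open import Relation.Binary.Structures using (IsTotalOrder)

-- The real numbers, axiomatised as a (Dedekind-)complete ordered field
-- equipped with the square-root function on non-negative elements.
-- Any such structure is isomorphic to ℝ, so quantifying over all of them
-- is the same as speaking about ℝ.

record RealField : Set₁ where
  infixl 6 _+_
  infixl 7 _*_
  infix 4 _≤_
  field
    Carrier : Set
    _+_ _*_ : Carrier → Carrier → Carrier
    -_      : Carrier → Carrier
    0# 1#   : Carrier
    _≤_     : Carrier → Carrier → Set
    isCommutativeRing : IsCommutativeRing _≡_ _+_ _*_ -_ 0# 1#
    0≢1     : 0# ≢ 1#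
    inverse : ∀ x → x ≢ 0# → Σ Carrier (λ y → x * y ≡ 1#)
    isTotalOrder : IsTotalOrder _≡_ _≤_
    +-mono  : ∀ {x y} z → x ≤ y → x + z ≤ y + z
    *-nonneg : ∀ {x y} → 0# ≤ x → 0# ≤ y → 0# ≤ x * y
    sup : (P : Carrier → Set) → ∃ P → ∃ (λ b → ∀ x → P x → x ≤ b) →
          ∃ (λ s → (∀ x → P x → x ≤ s) × (∀ b → (∀ x → P x → x ≤ b) → s ≤ b))
    sqrt       : Carrier → Carrier
    sqrt-nonneg : ∀ x → 0# ≤ x → 0# ≤ sqrt x
    sqrt-sq     : ∀ x → 0# ≤ x → sqrt x * sqrt x ≡ x

  fromℕ : ℕ → Carrier
  fromℕ zero    = 0#
  fromℕ (suc n) = 1# + fromℕ n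

∑ℕ : ∀ {n} → (Fin n → ℕ) → ℕ
∑ℕ {zero}  f = 0
∑ℕ {suc n} f = f zero ℕ.+ ∑ℕ (λ i → f (suc i))

module _ (R : RealField) where
  open RealField R
  ∑ : ∀ {n} → (Fin n → Carrier) → Carrier
  ∑ {zero}  f = 0#
  ∑ {suc n} f = f zero + ∑ (λ i → f (suc i))

record Graph (n : ℕ) : Set where
  field
    adj   : Fin n → Fin n → Bool
    sym   : ∀ i j → adj i j ≡ adj j i
    irrefl : ∀ i → adj i i ≡ false

Adj : ℕ → Set
Adj n = Fin n → Fin n → Bool

deg : ∀ {n} → Adj n → Fin n → ℕ
deg a i = ∑ℕ (λ j → if a i j then 1 else 0)

-- i < j test (to count each edge once)
_<ᵇ_ : ∀ {n} → Fin n → Fin n → Bool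
i <ᵇ j = ⌊ toℕ i ℕ.<? toℕ j ⌋

edges : ∀ {n} → Adj n → ℕ
edges a = ∑ℕ (λ i → ∑ℕ (λ j → if a i j ∧ (i <ᵇ j) then 1 else 0))

minF : ∀ {k} → (Fin (suc k) → ℕ) → ℕ
minF {zero}  f = f zero
minF {suc k} f = f zero ⊓ minF (λ i → f (suc i))

maxF : ∀ {k} → (Fin (suc k) → ℕ) → ℕ
maxF {zero}  f = f zero
maxF {suc k} f = f zero ⊔ maxF (λ i → f (suc i))

minDeg : ∀ {k} → Graph (suc k) → ℕ
minDeg G = minF (deg (Graph.adj G))

maxDeg : ∀ {k} → Graph (suc k) → ℕ
maxDeg G = maxF (deg (Graph.adj G))

joinAdj : ∀ {n₁ n₂} → Adj n₁ → Adj n₂ → Adj (n₁ ℕ.+ n₂)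
joinAdj {n₁} a₁ a₂ u v with splitAt n₁ u | splitAt n₁ v
... | inj₁ x | inj₁ y = a₁ x y
... | inj₂ x | inj₂ y = a₂ x y
... | inj₁ _ | inj₂ _ = true
... | inj₂ _ | inj₁ _ = true

_⊕_ : ∀ {n₁ n₂} → Graph n₁ → Graph n₂ → Adj (n₁ ℕ.+ n₂)
G₁ ⊕ G₂ = joinAdj (Graph.adj G₁) (Graph.adj G₂)

ESO : (R : RealField) → ∀ {n} → Adj n → RealField.Carrier R
ESO R a = ∑ R (λ i → ∑ R (λ j →
  if a i j ∧ (i <ᵇ j)
  then (fromℕ (deg a i) + fromℕ (deg a j)) *
         sqrt (fromℕ (deg a i) * fromℕ (deg a i) + fromℕ (deg a j) * fromℕ (deg a j))
  else 0#))
  where open RealField R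

-- In G₁ + G₂ a vertex of G₁ has degree d(v) + n₂ and a vertex of G₂ has degree d(v) + n₁, and the
-- edges of the join are those of G₁, those of G₂ and the n₁ n₂ cross edges. The edge term
-- (x + y) √(x² + y²) is monotone in x, y ≥ 0, so replacing every degree by δ + n (or Δ + n) on its
-- side bounds the index; with constant degrees the three edge classes contribute
-- 2√2 m₁ (δ₁ + n₂)², 2√2 m₂ (δ₂ + n₁)² and the cross term, since √(x² + x²) = √2 x.
-- The uniqueness of non-negative square roots behind the last identity uses the Archimedean
-- property, which follows from completeness.

module Submission where

open import Defs
open import Algebra.Bundles using (CommutativeRing)
open import Algebra.Structures using (IsCommutativeRing)
import Algebra.Properties.Group as GroupProperties
import Algebra.Properties.CommutativeSemigroup as CommutativeSemigroupProperties
import Algebra.Properties.Ring as RingProperties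
open import Data.Bool using (Bool; true; false; if_then_else_; _∧_)
open import Data.Fin using (Fin; zero; suc; toℕ; _↑ˡ_; _↑ʳ_)
open import Data.Fin.Properties using (splitAt-↑ˡ; splitAt-↑ʳ; toℕ-↑ˡ; toℕ-↑ʳ; toℕ<n)
open import Data.Nat as ℕ using (ℕ; zero; suc)
import Data.Nat.Properties as ℕ
open import Data.Product using (∃; _×_; _,_)
open import Data.Sum using (inj₁; inj₂)
open import Data.Empty using (⊥-elim)
open import Relation.Binary.Bundles using (Poset)
open import Relation.Binary.PropositionalEquality using (_≡_; refl; sym; trans; cong; cong₂; module ≡-Reasoning)
open import Relation.Binary.Structures using (IsTotalOrder)
import Relation.Binary.Reasoning.PartialOrder as PosetReasoning
open import Relation.Nullary.Decidable using (⌊_⌋; isYes≗does; dec-true; dec-false; does-⇔)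
open import Relation.Nullary.Negation using (¬_)
open import Function.Bundles using (_⇔_; mk⇔)
import Algebra.Solver.Ring.NaturalCoefficients.Default as Solver

∑ℕ-cong : ∀ {n} {f g : Fin n → ℕ} → (∀ i → f i ≡ g i) → ∑ℕ f ≡ ∑ℕ g
∑ℕ-cong {zero}  f≗g = refl
∑ℕ-cong {suc n} f≗g = cong₂ ℕ._+_ (f≗g zero) (∑ℕ-cong (λ i → f≗g (suc i)))

∑ℕ-split : ∀ n₁ {n₂} (f : Fin (n₁ ℕ.+ n₂) → ℕ) →
           ∑ℕ f ≡ ∑ℕ (λ i → f (i ↑ˡ n₂)) ℕ.+ ∑ℕ (λ j → f (n₁ ↑ʳ j))
∑ℕ-split zero     f = refl
∑ℕ-split (suc n₁) f = trans (cong (f zero ℕ.+_) (∑ℕ-split n₁ (λ i → f (suc i))))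
                            (sym (ℕ.+-assoc (f zero) _ _))

∑ℕ-const-1 : ∀ n → ∑ℕ {n} (λ _ → 1) ≡ n
∑ℕ-const-1 zero    = refl
∑ℕ-const-1 (suc n) = cong suc (∑ℕ-const-1 n)

minF≤ : ∀ {k} (f : Fin (suc k) → ℕ) i → minF f ℕ.≤ f i
minF≤ {zero}  f zero    = ℕ.≤-refl
minF≤ {suc k} f zero    = ℕ.m⊓n≤m _ _
minF≤ {suc k} f (suc i) = ℕ.≤-trans (ℕ.m⊓n≤n _ _) (minF≤ (λ i → f (suc i)) i)

≤maxF : ∀ {k} (f : Fin (suc k) → ℕ) i → f i ℕ.≤ maxF f
≤maxF {zero}  f zero    = ℕ.≤-refl
≤maxF {suc k} f zero    = ℕ.m≤m⊔n _ _
≤maxF {suc k} f (suc i) = ℕ.≤-trans (≤maxF (λ i → f (suc i)) i) (ℕ.m≤n⊔m _ _)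

indicator : Bool → ℕ
indicator b = if b then 1 else 0

forwardEdge : ∀ {n} → Adj n → Fin n → Fin n → Bool
forwardEdge a i j = a i j ∧ (i <ᵇ j)

<?-true : ∀ {a b} → a ℕ.< b → ⌊ a ℕ.<? b ⌋ ≡ true
<?-true {a} {b} a<b = trans (isYes≗does (a ℕ.<? b)) (dec-true (a ℕ.<? b) a<b)

<?-false : ∀ {a b} → ¬ a ℕ.< b → ⌊ a ℕ.<? b ⌋ ≡ false
<?-false {a} {b} a≮b = trans (isYes≗does (a ℕ.<? b)) (dec-false (a ℕ.<? b) a≮b)

<?-⇔ : ∀ {a b c d} → a ℕ.< b ⇔ c ℕ.< d → ⌊ a ℕ.<? b ⌋ ≡ ⌊ c ℕ.<? d ⌋
<?-⇔ {a} {b} {c} {d} a<b⇔c<d =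
  trans (isYes≗does (a ℕ.<? b))
        (trans (does-⇔ a<b⇔c<d (a ℕ.<? b) (c ℕ.<? d)) (sym (isYes≗does (c ℕ.<? d))))

module _ {n₁ n₂ : ℕ} (a₁ : Adj n₁) (a₂ : Adj n₂) where

  joinAdj-↑ˡ-↑ˡ : ∀ i j → joinAdj a₁ a₂ (i ↑ˡ n₂) (j ↑ˡ n₂) ≡ a₁ i j
  joinAdj-↑ˡ-↑ˡ i j rewrite splitAt-↑ˡ n₁ i n₂ | splitAt-↑ˡ n₁ j n₂ = refl

  joinAdj-↑ˡ-↑ʳ : ∀ i j → joinAdj a₁ a₂ (i ↑ˡ n₂) (n₁ ↑ʳ j) ≡ true
  joinAdj-↑ˡ-↑ʳ i j rewrite splitAt-↑ˡ n₁ i n₂ | splitAt-↑ʳ n₁ n₂ j = refl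

  joinAdj-↑ʳ-↑ˡ : ∀ i j → joinAdj a₁ a₂ (n₁ ↑ʳ i) (j ↑ˡ n₂) ≡ true
  joinAdj-↑ʳ-↑ˡ i j rewrite splitAt-↑ʳ n₁ n₂ i | splitAt-↑ˡ n₁ j n₂ = refl

  joinAdj-↑ʳ-↑ʳ : ∀ i j → joinAdj a₁ a₂ (n₁ ↑ʳ i) (n₁ ↑ʳ j) ≡ a₂ i j
  joinAdj-↑ʳ-↑ʳ i j rewrite splitAt-↑ʳ n₁ n₂ i | splitAt-↑ʳ n₁ n₂ j = refl

  deg-joinAdj-↑ˡ : ∀ i → deg (joinAdj a₁ a₂) (i ↑ˡ n₂) ≡ deg a₁ i ℕ.+ n₂
  deg-joinAdj-↑ˡ i = begin
    deg (joinAdj a₁ a₂) (i ↑ˡ n₂)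
      ≡⟨ ∑ℕ-split n₁ (λ v → indicator (joinAdj a₁ a₂ (i ↑ˡ n₂) v)) ⟩
    ∑ℕ (λ j → indicator (joinAdj a₁ a₂ (i ↑ˡ n₂) (j ↑ˡ n₂)))
      ℕ.+ ∑ℕ (λ j → indicator (joinAdj a₁ a₂ (i ↑ˡ n₂) (n₁ ↑ʳ j)))
      ≡⟨ cong₂ ℕ._+_ (∑ℕ-cong (λ j → cong indicator (joinAdj-↑ˡ-↑ˡ i j)))
                     (∑ℕ-cong (λ j → cong indicator (joinAdj-↑ˡ-↑ʳ i j))) ⟩
    deg a₁ i ℕ.+ ∑ℕ {n₂} (λ _ → 1)
      ≡⟨ cong (deg a₁ i ℕ.+_) (∑ℕ-const-1 n₂) ⟩
    deg a₁ i ℕ.+ n₂ ∎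
    where open ≡-Reasoning

  deg-joinAdj-↑ʳ : ∀ j → deg (joinAdj a₁ a₂) (n₁ ↑ʳ j) ≡ deg a₂ j ℕ.+ n₁
  deg-joinAdj-↑ʳ j = begin
    deg (joinAdj a₁ a₂) (n₁ ↑ʳ j)
      ≡⟨ ∑ℕ-split n₁ (λ v → indicator (joinAdj a₁ a₂ (n₁ ↑ʳ j) v)) ⟩
    ∑ℕ (λ i → indicator (joinAdj a₁ a₂ (n₁ ↑ʳ j) (i ↑ˡ n₂)))
      ℕ.+ ∑ℕ (λ i → indicator (joinAdj a₁ a₂ (n₁ ↑ʳ j) (n₁ ↑ʳ i)))
      ≡⟨ cong₂ ℕ._+_ (∑ℕ-cong (λ i → cong indicator (joinAdj-↑ʳ-↑ˡ j i)))
                     (∑ℕ-cong (λ i → cong indicator (joinAdj-↑ʳ-↑ʳ j i))) ⟩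
    ∑ℕ {n₁} (λ _ → 1) ℕ.+ deg a₂ j
      ≡⟨ cong (ℕ._+ deg a₂ j) (∑ℕ-const-1 n₁) ⟩
    n₁ ℕ.+ deg a₂ j
      ≡⟨ ℕ.+-comm n₁ (deg a₂ j) ⟩
    deg a₂ j ℕ.+ n₁ ∎
    where open ≡-Reasoning

  forwardEdge-joinAdj-↑ˡ-↑ˡ : ∀ i j → forwardEdge (joinAdj a₁ a₂) (i ↑ˡ n₂) (j ↑ˡ n₂) ≡ forwardEdge a₁ i j
  forwardEdge-joinAdj-↑ˡ-↑ˡ i j rewrite joinAdj-↑ˡ-↑ˡ i j | toℕ-↑ˡ i n₂ | toℕ-↑ˡ j n₂ = refl

  forwardEdge-joinAdj-↑ʳ-↑ʳ : ∀ i j → forwardEdge (joinAdj a₁ a₂) (n₁ ↑ʳ i) (n₁ ↑ʳ j) ≡ forwardEdge a₂ i j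
  forwardEdge-joinAdj-↑ʳ-↑ʳ i j rewrite joinAdj-↑ʳ-↑ʳ i j | toℕ-↑ʳ n₁ i | toℕ-↑ʳ n₁ j =
    cong (a₂ i j ∧_) (<?-⇔ (mk⇔ (ℕ.+-cancelˡ-< n₁ _ _) (ℕ.+-monoʳ-< n₁)))

  forwardEdge-joinAdj-↑ˡ-↑ʳ : ∀ i j → forwardEdge (joinAdj a₁ a₂) (i ↑ˡ n₂) (n₁ ↑ʳ j) ≡ true
  forwardEdge-joinAdj-↑ˡ-↑ʳ i j rewrite joinAdj-↑ˡ-↑ʳ i j | toℕ-↑ˡ i n₂ | toℕ-↑ʳ n₁ j =
    <?-true (ℕ.<-≤-trans (toℕ<n i) (ℕ.m≤m+n n₁ (toℕ j)))

  forwardEdge-joinAdj-↑ʳ-↑ˡ : ∀ i j → forwardEdge (joinAdj a₁ a₂) (n₁ ↑ʳ i) (j ↑ˡ n₂) ≡ false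
  forwardEdge-joinAdj-↑ʳ-↑ˡ i j rewrite joinAdj-↑ʳ-↑ˡ i j | toℕ-↑ʳ n₁ i | toℕ-↑ˡ j n₂ =
    <?-false (ℕ.≤⇒≯ (ℕ.≤-trans (ℕ.<⇒≤ (toℕ<n j)) (ℕ.m≤m+n n₁ (toℕ i))))

module _ (R : RealField) where

  open RealField R renaming (+-mono to +-monoˡ-≤)
  open IsCommutativeRing isCommutativeRing
    using (+-assoc; +-comm; *-comm; +-identityˡ; +-identityʳ; *-identityˡ; *-identityʳ; zeroˡ; zeroʳ; -‿inverseʳ; distribˡ; distribʳ)
  open IsTotalOrder isTotalOrder using (total; antisym)
    renaming (refl to ≤-refl; trans to ≤-trans; reflexive to ≤-reflexive)

  private
    commutativeRing : CommutativeRing _ _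
    commutativeRing = record { isCommutativeRing = isCommutativeRing }

    poset : Poset _ _ _
    poset = record { isPartialOrder = IsTotalOrder.isPartialOrder isTotalOrder }

  open GroupProperties (CommutativeRing.+-group commutativeRing)
    using (//-rightDividesˡ; //-rightDividesʳ; \\-leftDividesʳ; ⁻¹-involutive)
  open CommutativeSemigroupProperties (CommutativeRing.+-commutativeSemigroup commutativeRing)
    using () renaming (interchange to +-interchange)
  open CommutativeSemigroupProperties (CommutativeRing.*-commutativeSemigroup commutativeRing)
    using () renaming (interchange to *-interchange)
  open RingProperties (CommutativeRing.ring commutativeRing) using (-1*x≈-x)
  open Solver (CommutativeRing.commutativeSemiring commutativeRing) using (solve; _:+_; _:*_; _:=_)
  module ≤-Reasoning = PosetReasoning poset

  x-y+y≡x : ∀ x y → x + - y + y ≡ x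
  x-y+y≡x x y = //-rightDividesˡ y x

  x+y-y≡x : ∀ x y → x + y + - y ≡ x
  x+y-y≡x x y = //-rightDividesʳ y x

  -x+[x+y]≡y : ∀ x y → - x + (x + y) ≡ y
  -x+[x+y]≡y = \\-leftDividesʳ

  +-monoʳ-≤ : ∀ z {x y} → x ≤ y → z + x ≤ z + y
  +-monoʳ-≤ z {x} {y} x≤y = begin
    z + x  ≡⟨ +-comm z x ⟩
    x + z  ≤⟨ +-monoˡ-≤ z x≤y ⟩
    y + z  ≡⟨ +-comm y z ⟩
    z + y  ∎
    where open ≤-Reasoning

  +-mono-≤ : ∀ {x y u v} → x ≤ y → u ≤ v → x + u ≤ y + v
  +-mono-≤ {y = y} {u = u} x≤y u≤v = ≤-trans (+-monoˡ-≤ u x≤y) (+-monoʳ-≤ y u≤v)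

  +-cancelˡ-≤ : ∀ z {x y} → z + x ≤ z + y → x ≤ y
  +-cancelˡ-≤ z {x} {y} z+x≤z+y = begin
    x              ≡⟨ -x+[x+y]≡y z x ⟨
    - z + (z + x)  ≤⟨ +-monoʳ-≤ (- z) z+x≤z+y ⟩
    - z + (z + y)  ≡⟨ -x+[x+y]≡y z y ⟩
    y              ∎
    where open ≤-Reasoning

  +-cancelʳ-≤ : ∀ z {x y} → x + z ≤ y + z → x ≤ y
  +-cancelʳ-≤ z {x} {y} x+z≤y+z = begin
    x            ≡⟨ x+y-y≡x x z ⟨
    x + z + - z  ≤⟨ +-monoˡ-≤ (- z) x+z≤y+z ⟩
    y + z + - z  ≡⟨ x+y-y≡x y z ⟩
    y            ∎
    where open ≤-Reasoning

  x≤x+y : ∀ x {y} → 0# ≤ y → x ≤ x + y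
  x≤x+y x {y} 0≤y = begin
    x       ≡⟨ +-identityʳ x ⟨
    x + 0#  ≤⟨ +-monoʳ-≤ x 0≤y ⟩
    x + y   ∎
    where open ≤-Reasoning

  x+y≤z⇒x≤z-y : ∀ {x y z} → x + y ≤ z → x ≤ z + - y
  x+y≤z⇒x≤z-y {x} {y} {z} x+y≤z = begin
    x            ≡⟨ x+y-y≡x x y ⟨
    x + y + - y  ≤⟨ +-monoˡ-≤ (- y) x+y≤z ⟩
    z + - y      ∎
    where open ≤-Reasoning

  x≤y⇒0≤y-x : ∀ {x y} → x ≤ y → 0# ≤ y + - x
  x≤y⇒0≤y-x {x} {y} x≤y = begin
    0#       ≡⟨ -‿inverseʳ x ⟨
    x + - x  ≤⟨ +-monoˡ-≤ (- x) x≤y ⟩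
    y + - x  ∎
    where open ≤-Reasoning

  +-nonneg : ∀ {x y} → 0# ≤ x → 0# ≤ y → 0# ≤ x + y
  +-nonneg {x} {y} 0≤x 0≤y = ≤-trans 0≤x (x≤x+y x 0≤y)

  0≤1 : 0# ≤ 1#
  0≤1 with total 0# 1#
  ... | inj₁ 0≤1 = 0≤1
  ... | inj₂ 1≤0 = begin
    0#           ≤⟨ *-nonneg 0≤-1 0≤-1 ⟩
    - 1# * - 1#  ≡⟨ -1*x≈-x (- 1#) ⟩
    - (- 1#)     ≡⟨ ⁻¹-involutive 1# ⟩
    1#           ∎
    where
      open ≤-Reasoning
      0≤-1 : 0# ≤ - 1#
      0≤-1 = ≤-trans (x≤y⇒0≤y-x 1≤0) (≤-reflexive (+-identityˡ (- 1#)))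

  *-monoˡ-≤ : ∀ {x y z} → 0# ≤ z → x ≤ y → x * z ≤ y * z
  *-monoˡ-≤ {x} {y} {z} 0≤z x≤y = begin
    x * z                  ≡⟨ +-identityˡ (x * z) ⟨
    0# + x * z             ≤⟨ +-monoˡ-≤ (x * z) (*-nonneg (x≤y⇒0≤y-x x≤y) 0≤z) ⟩
    (y + - x) * z + x * z  ≡⟨ distribʳ z (y + - x) x ⟨
    (y + - x + x) * z      ≡⟨ cong (_* z) (x-y+y≡x y x) ⟩
    y * z                  ∎
    where open ≤-Reasoning

  *-mono-≤ : ∀ {x y u v} → 0# ≤ x → 0# ≤ u → x ≤ y → u ≤ v → x * u ≤ y * v
  *-mono-≤ {x} {y} {u} {v} 0≤x 0≤u x≤y u≤v = begin
    x * u  ≤⟨ *-monoˡ-≤ 0≤u x≤y ⟩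
    y * u  ≡⟨ *-comm y u ⟩
    u * y  ≤⟨ *-monoˡ-≤ (≤-trans 0≤x x≤y) u≤v ⟩
    v * y  ≡⟨ *-comm v y ⟩
    y * v  ∎
    where open ≤-Reasoning

  fromℕ-+ : ∀ m n → fromℕ (m ℕ.+ n) ≡ fromℕ m + fromℕ n
  fromℕ-+ zero    n = sym (+-identityˡ (fromℕ n))
  fromℕ-+ (suc m) n = trans (cong (1# +_) (fromℕ-+ m n)) (sym (+-assoc 1# (fromℕ m) (fromℕ n)))

  fromℕ-suc-* : ∀ n x → fromℕ (suc n) * x ≡ x + fromℕ n * x
  fromℕ-suc-* n x = trans (distribʳ x 1# (fromℕ n)) (cong (_+ fromℕ n * x) (*-identityˡ x))

  fromℕ-2-* : ∀ x → fromℕ 2 * x ≡ x + x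
  fromℕ-2-* x = begin
    fromℕ 2 * x      ≡⟨ fromℕ-suc-* 1 x ⟩
    x + fromℕ 1 * x  ≡⟨ cong (x +_) (fromℕ-suc-* 0 x) ⟩
    x + (x + 0# * x) ≡⟨ cong (λ t → x + (x + t)) (zeroˡ x) ⟩
    x + (x + 0#)     ≡⟨ cong (x +_) (+-identityʳ x) ⟩
    x + x            ∎
    where open ≡-Reasoning

  fromℕ-nonneg : ∀ n → 0# ≤ fromℕ n
  fromℕ-nonneg zero    = ≤-refl
  fromℕ-nonneg (suc n) = +-nonneg 0≤1 (fromℕ-nonneg n)

  fromℕ-mono : ∀ {m n} → m ℕ.≤ n → fromℕ m ≤ fromℕ n
  fromℕ-mono {m} m≤n with ℕ.m≤n⇒∃[o]m+o≡n m≤n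
  ... | o , refl = ≤-trans (x≤x+y (fromℕ m) (fromℕ-nonneg o)) (≤-reflexive (sym (fromℕ-+ m o)))

  -- The Archimedean property: the supremum s of the multiples of w satisfies s ≤ s - w.
  multiples-bounded⇒≤0 : ∀ {w b} → (∀ n → fromℕ n * w ≤ b) → w ≤ 0#
  multiples-bounded⇒≤0 {w} {b} bounded =
    w≤0 (sup Multiple (fromℕ 0 * w , 0 , refl) (b , λ { _ (n , refl) → bounded n }))
    where
      Multiple : Carrier → Set
      Multiple x = ∃ λ n → x ≡ fromℕ n * w

      w≤0 : ∃ (λ s → (∀ x → Multiple x → x ≤ s) × (∀ c → (∀ x → Multiple x → x ≤ c) → s ≤ c)) →
            w ≤ 0#
      w≤0 (s , upper , least) = +-cancelˡ-≤ s (begin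
        s + w        ≤⟨ +-monoˡ-≤ w s≤s-w ⟩
        s + - w + w  ≡⟨ x-y+y≡x s w ⟩
        s            ≡⟨ +-identityʳ s ⟨
        s + 0#       ∎)
        where
          open ≤-Reasoning
          s≤s-w : s ≤ s + - w
          s≤s-w = least (s + - w) λ { _ (n , refl) → x+y≤z⇒x≤z-y (begin
            fromℕ n * w + w      ≡⟨ +-comm (fromℕ n * w) w ⟩
            w + fromℕ n * w      ≡⟨ fromℕ-suc-* n w ⟨
            fromℕ (suc n) * w    ≤⟨ upper _ (suc n , refl) ⟩
            s                    ∎) }

  -- Inverses cannot be used here, as w ≡ 0# is not decidable.
  square≡0⇒≤0 : ∀ {w} → w * w ≡ 0# → w ≤ 0#
  square≡0⇒≤0 {w} w*w≡0 = multiples-bounded⇒≤0 nw≤1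
    where
      nw≤1 : ∀ n → fromℕ n * w ≤ 1#
      nw≤1 n with total (fromℕ n * w) 1#
      ... | inj₁ nw≤1 = nw≤1
      ... | inj₂ 1≤nw = ⊥-elim (0≢1 (antisym 0≤1 (begin
        1#                                  ≡⟨ *-identityˡ 1# ⟨
        1# * 1#                             ≤⟨ *-mono-≤ 0≤1 0≤1 1≤nw 1≤nw ⟩
        fromℕ n * w * (fromℕ n * w)         ≡⟨ *-interchange (fromℕ n) w (fromℕ n) w ⟩
        fromℕ n * fromℕ n * (w * w)         ≡⟨ cong (fromℕ n * fromℕ n *_) w*w≡0 ⟩
        fromℕ n * fromℕ n * 0#              ≡⟨ zeroʳ _ ⟩
        0#                                  ∎)))
        where open ≤-Reasoning

  square-+ : ∀ w q → (w + q) * (w + q) ≡ w * w + (w * q + w * q) + q * q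
  square-+ = solve 2 (λ w q → (w :+ q) :* (w :+ q) := w :* w :+ (w :* q :+ w :* q) :+ q :* q) refl

  square-≡⇒≤ : ∀ {p q} → 0# ≤ q → q ≤ p → p * p ≡ q * q → p ≤ q
  square-≡⇒≤ {p} {q} 0≤q q≤p p*p≡q*q = begin
    p            ≡⟨ x-y+y≡x p q ⟨
    w + q        ≤⟨ +-monoˡ-≤ q (square≡0⇒≤0 (antisym w*w≤0 (*-nonneg 0≤w 0≤w))) ⟩
    0# + q       ≡⟨ +-identityˡ q ⟩
    q            ∎
    where
      open ≤-Reasoning
      w : Carrier
      w = p + - q
      0≤w : 0# ≤ w
      0≤w = x≤y⇒0≤y-x q≤p
      w*w≤0 : w * w ≤ 0#
      w*w≤0 = +-cancelʳ-≤ (q * q) (begin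
        w * w + q * q                    ≤⟨ +-monoˡ-≤ (q * q) (x≤x+y (w * w) (+-nonneg 0≤wq 0≤wq)) ⟩
        w * w + (w * q + w * q) + q * q  ≡⟨ square-+ w q ⟨
        (w + q) * (w + q)                ≡⟨ cong (λ x → x * x) (x-y+y≡x p q) ⟩
        p * p                            ≡⟨ p*p≡q*q ⟩
        q * q                            ≡⟨ +-identityˡ (q * q) ⟨
        0# + q * q                       ∎)
        where
          0≤wq : 0# ≤ w * q
          0≤wq = *-nonneg 0≤w 0≤q

  square-injective : ∀ {p q} → 0# ≤ p → 0# ≤ q → p * p ≡ q * q → p ≡ q
  square-injective {p} {q} 0≤p 0≤q p*p≡q*q with total p q
  ... | inj₁ p≤q = antisym p≤q (square-≡⇒≤ 0≤p p≤q (sym p*p≡q*q))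
  ... | inj₂ q≤p = antisym (square-≡⇒≤ 0≤q q≤p p*p≡q*q) q≤p

  sqrt-square : ∀ {p} → 0# ≤ p → sqrt (p * p) ≡ p
  sqrt-square {p} 0≤p = square-injective (sqrt-nonneg _ 0≤p*p) 0≤p (sqrt-sq _ 0≤p*p)
    where
      0≤p*p : 0# ≤ p * p
      0≤p*p = *-nonneg 0≤p 0≤p

  sqrt-mono : ∀ {x y} → 0# ≤ x → x ≤ y → sqrt x ≤ sqrt y
  sqrt-mono {x} {y} 0≤x x≤y with total (sqrt x) (sqrt y)
  ... | inj₁ √x≤√y = √x≤√y
  ... | inj₂ √y≤√x = ≤-reflexive (cong sqrt (antisym x≤y y≤x))
    where
      open ≤-Reasoning
      0≤y : 0# ≤ y
      0≤y = ≤-trans 0≤x x≤y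
      y≤x : y ≤ x
      y≤x = begin
        y                  ≡⟨ sqrt-sq y 0≤y ⟨
        sqrt y * sqrt y    ≤⟨ *-mono-≤ (sqrt-nonneg y 0≤y) (sqrt-nonneg y 0≤y) √y≤√x √y≤√x ⟩
        sqrt x * sqrt x    ≡⟨ sqrt-sq x 0≤x ⟩
        x                  ∎

  ellipticTerm : Carrier → Carrier → Carrier
  ellipticTerm x y = (x + y) * sqrt (x * x + y * y)

  ellipticTerm-mono : ∀ {x y x′ y′} → 0# ≤ x → 0# ≤ y → x ≤ x′ → y ≤ y′ →
                      ellipticTerm x y ≤ ellipticTerm x′ y′
  ellipticTerm-mono {x} {y} 0≤x 0≤y x≤x′ y≤y′ =
    *-mono-≤ (+-nonneg 0≤x 0≤y) (sqrt-nonneg _ 0≤x²+y²) (+-mono-≤ x≤x′ y≤y′)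
      (sqrt-mono 0≤x²+y² (+-mono-≤ (*-mono-≤ 0≤x 0≤x x≤x′ x≤x′) (*-mono-≤ 0≤y 0≤y y≤y′ y≤y′)))
    where
      0≤x²+y² : 0# ≤ x * x + y * y
      0≤x²+y² = +-nonneg (*-nonneg 0≤x 0≤x) (*-nonneg 0≤y 0≤y)

  ellipticTerm-diag : ∀ {x} → 0# ≤ x → ellipticTerm x x ≡ fromℕ 2 * sqrt (fromℕ 2) * (x * x)
  ellipticTerm-diag {x} 0≤x = begin
    (x + x) * sqrt (x * x + x * x)  ≡⟨ cong₂ _*_ (fromℕ-2-* x) (cong sqrt (fromℕ-2-* (x * x))) ⟨
    (two * x) * sqrt (two * (x * x))
      ≡⟨ cong (λ t → two * x * sqrt (t * (x * x))) (sqrt-sq two (fromℕ-nonneg 2)) ⟨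
    (two * x) * sqrt (√2 * √2 * (x * x))
      ≡⟨ cong (λ t → two * x * sqrt t) (*-interchange √2 x √2 x) ⟨
    (two * x) * sqrt ((√2 * x) * (√2 * x))
      ≡⟨ cong (two * x *_) (sqrt-square (*-nonneg (sqrt-nonneg two (fromℕ-nonneg 2)) 0≤x)) ⟩
    (two * x) * (√2 * x)            ≡⟨ *-interchange two x √2 x ⟩
    two * √2 * (x * x)              ∎
    where
      open ≡-Reasoning
      two √2 : Carrier
      two = fromℕ 2
      √2 = sqrt two

  ∑-cong : ∀ {n} {f g : Fin n → Carrier} → (∀ i → f i ≡ g i) → ∑ R f ≡ ∑ R g
  ∑-cong {zero}  f≗g = refl
  ∑-cong {suc n} f≗g = cong₂ _+_ (f≗g zero) (∑-cong (λ i → f≗g (suc i)))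

  ∑-mono-≤ : ∀ {n} {f g : Fin n → Carrier} → (∀ i → f i ≤ g i) → ∑ R f ≤ ∑ R g
  ∑-mono-≤ {zero}  f≤g = ≤-refl
  ∑-mono-≤ {suc n} f≤g = +-mono-≤ (f≤g zero) (∑-mono-≤ (λ i → f≤g (suc i)))

  ∑-distrib-+ : ∀ {n} (f g : Fin n → Carrier) → ∑ R (λ i → f i + g i) ≡ ∑ R f + ∑ R g
  ∑-distrib-+ {zero}  f g = sym (+-identityˡ 0#)
  ∑-distrib-+ {suc n} f g =
    trans (cong (f zero + g zero +_) (∑-distrib-+ (λ i → f (suc i)) (λ i → g (suc i))))
          (+-interchange (f zero) (g zero) _ _)

  *-distribˡ-∑ : ∀ {n} c (f : Fin n → Carrier) → c * ∑ R f ≡ ∑ R (λ i → c * f i)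
  *-distribˡ-∑ {zero}  c f = zeroʳ c
  *-distribˡ-∑ {suc n} c f = trans (distribˡ c (f zero) _) (cong (c * f zero +_) (*-distribˡ-∑ c (λ i → f (suc i))))

  ∑-const : ∀ n c → ∑ R {n} (λ _ → c) ≡ fromℕ n * c
  ∑-const zero    c = sym (zeroˡ c)
  ∑-const (suc n) c = trans (cong (c +_) (∑-const n c)) (sym (fromℕ-suc-* n c))

  ∑-split : ∀ n₁ {n₂} (f : Fin (n₁ ℕ.+ n₂) → Carrier) →
            ∑ R f ≡ ∑ R (λ i → f (i ↑ˡ n₂)) + ∑ R (λ j → f (n₁ ↑ʳ j))
  ∑-split zero     f = sym (+-identityˡ _)
  ∑-split (suc n₁) f = trans (cong (f zero +_) (∑-split n₁ (λ i → f (suc i)))) (sym (+-assoc (f zero) _ _))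

  fromℕ-∑ : ∀ {n} (f : Fin n → ℕ) → fromℕ (∑ℕ f) ≡ ∑ R (λ i → fromℕ (f i))
  fromℕ-∑ {zero}  f = refl
  fromℕ-∑ {suc n} f = trans (fromℕ-+ (f zero) _) (cong (fromℕ (f zero) +_) (fromℕ-∑ (λ i → f (suc i))))

  guard : Bool → Carrier → Carrier
  guard b x = if b then x else 0#

  guard-mono-≤ : ∀ b {x y} → x ≤ y → guard b x ≤ guard b y
  guard-mono-≤ true  x≤y = x≤y
  guard-mono-≤ false x≤y = ≤-refl

  guard≡*indicator : ∀ b x → guard b x ≡ x * fromℕ (indicator b)
  guard≡*indicator true  x = sym (trans (cong (x *_) (+-identityʳ 1#)) (*-identityʳ x))
  guard≡*indicator false x = sym (zeroʳ x)

  -- ESO R a is, by definition, edgeSum a (λ i j → ellipticTerm (fromℕ (deg a i)) (fromℕ (deg a j))).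
  edgeSum : ∀ {n} → Adj n → (Fin n → Fin n → Carrier) → Carrier
  edgeSum a w = ∑ R (λ i → ∑ R (λ j → guard (forwardEdge a i j) (w i j)))

  edgeSum-cong : ∀ {n} (a : Adj n) {w w′ : Fin n → Fin n → Carrier} →
                 (∀ i j → w i j ≡ w′ i j) → edgeSum a w ≡ edgeSum a w′
  edgeSum-cong a w≗w′ = ∑-cong (λ i → ∑-cong (λ j → cong (guard (forwardEdge a i j)) (w≗w′ i j)))

  edgeSum-mono-≤ : ∀ {n} (a : Adj n) {w w′ : Fin n → Fin n → Carrier} →
                   (∀ i j → w i j ≤ w′ i j) → edgeSum a w ≤ edgeSum a w′
  edgeSum-mono-≤ a w≤w′ = ∑-mono-≤ (λ i → ∑-mono-≤ (λ j → guard-mono-≤ (forwardEdge a i j) (w≤w′ i j)))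

  edgeSum-const : ∀ {n} (a : Adj n) c → edgeSum a (λ _ _ → c) ≡ c * fromℕ (edges a)
  edgeSum-const {n} a c = begin
    edgeSum a (λ _ _ → c)
      ≡⟨ ∑-cong (λ i → ∑-cong (λ j → guard≡*indicator (forwardEdge a i j) c)) ⟩
    ∑ R (λ i → ∑ R (λ j → c * fromℕ (isEdge i j)))
      ≡⟨ ∑-cong (λ i → *-distribˡ-∑ c (λ j → fromℕ (isEdge i j))) ⟨
    ∑ R (λ i → c * ∑ R (λ j → fromℕ (isEdge i j)))
      ≡⟨ *-distribˡ-∑ c (λ i → ∑ R (λ j → fromℕ (isEdge i j))) ⟨
    c * ∑ R (λ i → ∑ R (λ j → fromℕ (isEdge i j)))
      ≡⟨ cong (c *_) (trans (fromℕ-∑ (λ i → ∑ℕ (isEdge i))) (∑-cong (λ i → fromℕ-∑ (isEdge i)))) ⟨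
    c * fromℕ (edges a) ∎
    where
      open ≡-Reasoning
      isEdge : Fin n → Fin n → ℕ
      isEdge i j = indicator (forwardEdge a i j)

  edgeSum-joinAdj : ∀ {n₁ n₂} (a₁ : Adj n₁) (a₂ : Adj n₂) (w : Fin (n₁ ℕ.+ n₂) → Fin (n₁ ℕ.+ n₂) → Carrier) →
    edgeSum (joinAdj a₁ a₂) w
      ≡ edgeSum a₁ (λ i j → w (i ↑ˡ n₂) (j ↑ˡ n₂))
        + ∑ R (λ i → ∑ R (λ j → w (i ↑ˡ n₂) (n₁ ↑ʳ j)))
        + edgeSum a₂ (λ i j → w (n₁ ↑ʳ i) (n₁ ↑ʳ j))
  edgeSum-joinAdj {n₁} {n₂} a₁ a₂ w =
    trans (∑-split n₁ row)
          (cong₂ _+_ (trans (∑-cong rowˡ) (∑-distrib-+ {n₁} _ _)) (∑-cong rowʳ))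
    where
      term : Fin (n₁ ℕ.+ n₂) → Fin (n₁ ℕ.+ n₂) → Carrier
      term u v = guard (forwardEdge (joinAdj a₁ a₂) u v) (w u v)

      row : Fin (n₁ ℕ.+ n₂) → Carrier
      row u = ∑ R (term u)

      rowˡ : ∀ i → row (i ↑ˡ n₂) ≡ ∑ R (λ j → guard (forwardEdge a₁ i j) (w (i ↑ˡ n₂) (j ↑ˡ n₂)))
                                  + ∑ R (λ j → w (i ↑ˡ n₂) (n₁ ↑ʳ j))
      rowˡ i = trans (∑-split n₁ (term (i ↑ˡ n₂)))
        (cong₂ _+_ (∑-cong (λ j → cong (λ b → guard b _) (forwardEdge-joinAdj-↑ˡ-↑ˡ a₁ a₂ i j)))
                   (∑-cong (λ j → cong (λ b → guard b _) (forwardEdge-joinAdj-↑ˡ-↑ʳ a₁ a₂ i j))))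

      rowʳ : ∀ i → row (n₁ ↑ʳ i) ≡ ∑ R (λ j → guard (forwardEdge a₂ i j) (w (n₁ ↑ʳ i) (n₁ ↑ʳ j)))
      rowʳ i = begin
        row (n₁ ↑ʳ i)
          ≡⟨ ∑-split n₁ (term (n₁ ↑ʳ i)) ⟩
        ∑ R (λ j → term (n₁ ↑ʳ i) (j ↑ˡ n₂)) + ∑ R (λ j → term (n₁ ↑ʳ i) (n₁ ↑ʳ j))
          ≡⟨ cong₂ _+_ (∑-cong (λ j → cong (λ b → guard b _) (forwardEdge-joinAdj-↑ʳ-↑ˡ a₁ a₂ i j)))
                       (∑-cong (λ j → cong (λ b → guard b _) (forwardEdge-joinAdj-↑ʳ-↑ʳ a₁ a₂ i j))) ⟩
        ∑ R {n₁} (λ _ → 0#) + rowₐ₂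
          ≡⟨ cong (_+ rowₐ₂) (trans (∑-const n₁ 0#) (zeroʳ (fromℕ n₁))) ⟩
        0# + rowₐ₂
          ≡⟨ +-identityˡ rowₐ₂ ⟩
        rowₐ₂ ∎
        where
          open ≡-Reasoning
          rowₐ₂ : Carrier
          rowₐ₂ = ∑ R (λ j → guard (forwardEdge a₂ i j) (w (n₁ ↑ʳ i) (n₁ ↑ʳ j)))

  joinBound-rearrange : ∀ t s m₁ m₂ A B N₁ N₂ Q →
    t * s * (A * A) * m₁ + N₁ * (N₂ * ((A + B) * Q)) + t * s * (B * B) * m₂
    ≡ t * s * m₁ * (A * A) + t * s * m₂ * (B * B) + N₁ * N₂ * (A + B) * Q
  joinBound-rearrange = solve 9 (λ t s m₁ m₂ A B N₁ N₂ Q →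
    t :* s :* (A :* A) :* m₁ :+ N₁ :* (N₂ :* ((A :+ B) :* Q)) :+ t :* s :* (B :* B) :* m₂
    := t :* s :* m₁ :* (A :* A) :+ t :* s :* m₂ :* (B :* B) :+ N₁ :* N₂ :* (A :+ B) :* Q) refl

  module _ {n₁ n₂ : ℕ} (a₁ : Adj n₁) (a₂ : Adj n₂) where

    private
      N₁ N₂ m₁ m₂ two : Carrier
      N₁ = fromℕ n₁
      N₂ = fromℕ n₂
      m₁ = fromℕ (edges a₁)
      m₂ = fromℕ (edges a₂)
      two = fromℕ 2

    joinESO : (Fin n₁ → Carrier) → (Fin n₂ → Carrier) → Carrier
    joinESO x y = edgeSum a₁ (λ i j → ellipticTerm (x i) (x j))
                + ∑ R (λ i → ∑ R (λ j → ellipticTerm (x i) (y j)))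
                + edgeSum a₂ (λ i j → ellipticTerm (y i) (y j))

    joinBound : Carrier → Carrier → Carrier
    joinBound d₁ d₂ =
      two * sqrt two * m₁ * ((d₁ + N₂) * (d₁ + N₂))
      + two * sqrt two * m₂ * ((d₂ + N₁) * (d₂ + N₁))
      + N₁ * N₂ * (d₁ + N₂ + d₂ + N₁)
        * sqrt ((d₁ + N₂) * (d₁ + N₂) + (d₂ + N₁) * (d₂ + N₁))

    ESO-joinAdj : ESO R (joinAdj a₁ a₂) ≡
                  joinESO (λ i → fromℕ (deg a₁ i) + N₂) (λ j → fromℕ (deg a₂ j) + N₁)
    ESO-joinAdj =
      trans (edgeSum-joinAdj a₁ a₂ (λ u v → ellipticTerm (d u) (d v)))
            (cong₂ _+_ (cong₂ _+_ (edgeSum-cong a₁ (λ i j → cong₂ ellipticTerm (dˡ i) (dˡ j)))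
                                  (∑-cong (λ i → ∑-cong (λ j → cong₂ ellipticTerm (dˡ i) (dʳ j)))))
                       (edgeSum-cong a₂ (λ i j → cong₂ ellipticTerm (dʳ i) (dʳ j))))
      where
        d : Fin (n₁ ℕ.+ n₂) → Carrier
        d u = fromℕ (deg (joinAdj a₁ a₂) u)
        dˡ : ∀ i → d (i ↑ˡ n₂) ≡ fromℕ (deg a₁ i) + N₂
        dˡ i = trans (cong fromℕ (deg-joinAdj-↑ˡ a₁ a₂ i)) (fromℕ-+ (deg a₁ i) n₂)
        dʳ : ∀ j → d (n₁ ↑ʳ j) ≡ fromℕ (deg a₂ j) + N₁
        dʳ j = trans (cong fromℕ (deg-joinAdj-↑ʳ a₁ a₂ j)) (fromℕ-+ (deg a₂ j) n₁)

    joinESO-mono : ∀ {x x′ y y′} → (∀ i → 0# ≤ x i) → (∀ j → 0# ≤ y j) →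
                   (∀ i → x i ≤ x′ i) → (∀ j → y j ≤ y′ j) → joinESO x y ≤ joinESO x′ y′
    joinESO-mono 0≤x 0≤y x≤x′ y≤y′ =
      +-mono-≤ (+-mono-≤ (edgeSum-mono-≤ a₁ (λ i j → ellipticTerm-mono (0≤x i) (0≤x j) (x≤x′ i) (x≤x′ j)))
                         (∑-mono-≤ (λ i → ∑-mono-≤ (λ j → ellipticTerm-mono (0≤x i) (0≤y j) (x≤x′ i) (y≤y′ j)))))
               (edgeSum-mono-≤ a₂ (λ i j → ellipticTerm-mono (0≤y i) (0≤y j) (y≤y′ i) (y≤y′ j)))

    joinESO-const : ∀ {d₁ d₂} → 0# ≤ d₁ → 0# ≤ d₂ → joinESO (λ _ → d₁ + N₂) (λ _ → d₂ + N₁) ≡ joinBound d₁ d₂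
    joinESO-const {d₁} {d₂} 0≤d₁ 0≤d₂ = begin
      joinESO (λ _ → A) (λ _ → B)
        ≡⟨ cong₂ _+_ (cong₂ _+_ (edgeSum-const a₁ (ellipticTerm A A))
                                (trans (∑-cong {n₁} (λ _ → ∑-const n₂ (ellipticTerm A B))) (∑-const n₁ _)))
                     (edgeSum-const a₂ (ellipticTerm B B)) ⟩
      ellipticTerm A A * m₁ + N₁ * (N₂ * ellipticTerm A B) + ellipticTerm B B * m₂
        ≡⟨ cong₂ (λ s t → s * m₁ + N₁ * (N₂ * ellipticTerm A B) + t * m₂)
                 (ellipticTerm-diag 0≤A) (ellipticTerm-diag 0≤B) ⟩
      two * sqrt two * (A * A) * m₁ + N₁ * (N₂ * ((A + B) * Q)) + two * sqrt two * (B * B) * m₂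
        ≡⟨ joinBound-rearrange two (sqrt two) m₁ m₂ A B N₁ N₂ Q ⟩
      two * sqrt two * m₁ * (A * A) + two * sqrt two * m₂ * (B * B) + N₁ * N₂ * (A + B) * Q
        ≡⟨ cong (λ t → two * sqrt two * m₁ * (A * A) + two * sqrt two * m₂ * (B * B) + N₁ * N₂ * t * Q)
                (sym (+-assoc A d₂ N₁)) ⟩
      joinBound d₁ d₂ ∎
      where
        open ≡-Reasoning
        A B Q : Carrier
        A = d₁ + N₂
        B = d₂ + N₁
        Q = sqrt (A * A + B * B)
        0≤A : 0# ≤ A
        0≤A = +-nonneg 0≤d₁ (fromℕ-nonneg n₂)
        0≤B : 0# ≤ B
        0≤B = +-nonneg 0≤d₂ (fromℕ-nonneg n₁)

    ESO-joinAdj-≥ : ∀ {d₁ d₂} → 0# ≤ d₁ → 0# ≤ d₂ →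
                    (∀ i → d₁ ≤ fromℕ (deg a₁ i)) → (∀ j → d₂ ≤ fromℕ (deg a₂ j)) →
                    joinBound d₁ d₂ ≤ ESO R (joinAdj a₁ a₂)
    ESO-joinAdj-≥ {d₁} {d₂} 0≤d₁ 0≤d₂ d₁≤deg d₂≤deg = begin
      joinBound d₁ d₂                                     ≡⟨ joinESO-const 0≤d₁ 0≤d₂ ⟨
      joinESO (λ _ → d₁ + N₂) (λ _ → d₂ + N₁)
        ≤⟨ joinESO-mono (λ _ → +-nonneg 0≤d₁ (fromℕ-nonneg n₂)) (λ _ → +-nonneg 0≤d₂ (fromℕ-nonneg n₁))
                        (λ i → +-monoˡ-≤ N₂ (d₁≤deg i)) (λ j → +-monoˡ-≤ N₁ (d₂≤deg j)) ⟩
      joinESO (λ i → fromℕ (deg a₁ i) + N₂) (λ j → fromℕ (deg a₂ j) + N₁) ≡⟨ ESO-joinAdj ⟨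
      ESO R (joinAdj a₁ a₂)                               ∎
      where open ≤-Reasoning

    ESO-joinAdj-≤ : ∀ {d₁ d₂} → 0# ≤ d₁ → 0# ≤ d₂ →
                    (∀ i → fromℕ (deg a₁ i) ≤ d₁) → (∀ j → fromℕ (deg a₂ j) ≤ d₂) →
                    ESO R (joinAdj a₁ a₂) ≤ joinBound d₁ d₂
    ESO-joinAdj-≤ {d₁} {d₂} 0≤d₁ 0≤d₂ deg≤d₁ deg≤d₂ = begin
      ESO R (joinAdj a₁ a₂)                               ≡⟨ ESO-joinAdj ⟩
      joinESO (λ i → fromℕ (deg a₁ i) + N₂) (λ j → fromℕ (deg a₂ j) + N₁)
        ≤⟨ joinESO-mono (λ i → +-nonneg (fromℕ-nonneg (deg a₁ i)) (fromℕ-nonneg n₂))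
                        (λ j → +-nonneg (fromℕ-nonneg (deg a₂ j)) (fromℕ-nonneg n₁))
                        (λ i → +-monoˡ-≤ N₂ (deg≤d₁ i)) (λ j → +-monoˡ-≤ N₁ (deg≤d₂ j)) ⟩
      joinESO (λ _ → d₁ + N₂) (λ _ → d₂ + N₁)             ≡⟨ joinESO-const 0≤d₁ 0≤d₂ ⟩
      joinBound d₁ d₂                                     ∎
      where open ≤-Reasoning

theorem1 : (R : RealField) → (k₁ k₂ : ℕ) → (G₁ : Graph (suc k₁)) → (G₂ : Graph (suc k₂)) →
    let open RealField R
        n₁ = fromℕ (suc k₁)
        n₂ = fromℕ (suc k₂)
        m₁ = fromℕ (edges (Graph.adj G₁))
        m₂ = fromℕ (edges (Graph.adj G₂))
        δ₁ = fromℕ (minDeg G₁)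
        δ₂ = fromℕ (minDeg G₂)
        Δ₁ = fromℕ (maxDeg G₁)
        Δ₂ = fromℕ (maxDeg G₂)
        two = fromℕ 2
        α₁ = two * sqrt two * m₁ * ((δ₁ + n₂) * (δ₁ + n₂))
             + two * sqrt two * m₂ * ((δ₂ + n₁) * (δ₂ + n₁))
             + n₁ * n₂ * (δ₁ + n₂ + δ₂ + n₁)
               * sqrt ((δ₁ + n₂) * (δ₁ + n₂) + (δ₂ + n₁) * (δ₂ + n₁))
        α₂ = two * sqrt two * m₁ * ((Δ₁ + n₂) * (Δ₁ + n₂))
             + two * sqrt two * m₂ * ((Δ₂ + n₁) * (Δ₂ + n₁))
             + n₁ * n₂ * (Δ₁ + n₂ + Δ₂ + n₁)
               * sqrt ((Δ₁ + n₂) * (Δ₁ + n₂) + (Δ₂ + n₁) * (Δ₂ + n₁))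
    in (α₁ ≤ ESO R (G₁ ⊕ G₂)) × (ESO R (G₁ ⊕ G₂) ≤ α₂)
theorem1 R k₁ k₂ G₁ G₂ =
    ESO-joinAdj-≥ R a₁ a₂ (fromℕ-nonneg R (minDeg G₁)) (fromℕ-nonneg R (minDeg G₂))
      (λ i → fromℕ-mono R (minF≤ (deg a₁) i)) (λ j → fromℕ-mono R (minF≤ (deg a₂) j))
  , ESO-joinAdj-≤ R a₁ a₂ (fromℕ-nonneg R (maxDeg G₁)) (fromℕ-nonneg R (maxDeg G₂))
      (λ i → fromℕ-mono R (≤maxF (deg a₁) i)) (λ j → fromℕ-mono R (≤maxF (deg a₂) j))
  where
    a₁ : Adj (suc k₁)
    a₁ = Graph.adj G₁
    a₂ : Adj (suc k₂)
    a₂ = Graph.adj G₂
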